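{- If $G^c$ is a connected vertex-coloured graph with $n$ vertices and $c$ colours, where $n>c\ge 1$, then $\gamma^t(G^c)\le \frac{n+c-1}{2}$.
   Context: A vertex-coloured graph $G^c$ is a finite simple undirected graph in which each vertex receives exactly one colour from $\{1,\dots,c\}$ and every colour is used at least once. A tropical dominating set is a set $S$ of vertices such that every vertex is in $S$ or adjacent to a vertex of $S$, and every colour appears on some vertex of $S$; $\gamma^t(G^c)$ is the minimum size of a tropical dominating set. -}

module Defs where

open import Data.Nat using (ℕ; suc; _+_; _*_; _∸_; _≤_)
open import Data.Fin using (Fin)
open import Data.Fin.Subset using (Subset; _∈_; ∣_∣)
open import Data.Bool using (Bool; true; false)
open import Data.Product using (Σ; ∃; _×_; _,_)
open import Data.Sum using (_⊎_)
open import Relation.Binary.PropositionalEquality using (_≡_)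
open import Relation.Nullary using (¬_)
open import Function.Definitions using (Surjective)

record Graph (n : ℕ) : Set where
  field
    adj   : Fin n → Fin n → Bool
    sym   : ∀ u v → adj u v ≡ adj v u
    irrefl : ∀ v → adj v v ≡ false

open Graph public

Adj : ∀ {n} → Graph n → Fin n → Fin n → Set
Adj G u v = adj G u v ≡ true

data Walk {n : ℕ} (G : Graph n) : Fin n → Fin n → Set where
  here : ∀ {v} → Walk G v v
  step : ∀ {u w v} → Adj G u w → Walk G w v → Walk G u v

Connected : ∀ {n} → Graph n → Set
Connected G = ∀ u v → Walk G u v

record Colouring {n : ℕ} (c : ℕ) : Set where
  field
    col  : Fin n → Fin c
    onto : ∀ (i : Fin c) → ∃ λ v → col v ≡ i

open Colouring public

Dominating : ∀ {n} → Graph n → Subset n → Set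
Dominating {n} G S = ∀ (v : Fin n) → v ∈ S ⊎ (∃ λ u → u ∈ S × Adj G u v)

TropicalDominating : ∀ {n c} → Graph n → Colouring {n} c → Subset n → Set
TropicalDominating {n} {c} G κ S =
  Dominating G S × (∀ (i : Fin c) → ∃ λ v → v ∈ S × col κ v ≡ i)

-- Call a tropical dominating set S *stable* if every v ∈ S has a private
-- external neighbour (a vertex outside S adjacent to v and to no other vertex
-- of S) or is the only vertex of S with its colour.  If some v₀ ∈ S has a private neighbour, sending
--   each vertex of S to a private neighbour, or else to its colour, injects S
--   into (V ∖ S) ⊎ (colours ∖ {col v₀}); so ∣S∣ ≤ (n − ∣S∣) + (c − 1).
--   Otherwise the colouring is injective on S, so ∣S∣ ≤ c < n.
-- * Unstable sets improve.  If v ∈ S has no private neighbour and shares its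
--   colour, delete v when it has a neighbour in S, and otherwise swap v for a
--   neighbour w ∉ S (one exists as G is connected and n ≥ 2).  The result is
--   tropical dominating and smaller in the measure ∣S∣·(n+1) + #(vertices
--   isolated in S).
-- * Descent along this measure from S = V reaches a stable set.

module Submission where

open import Defs hiding (sym)
open import Data.Nat using (ℕ; zero; suc; _+_; _*_; _∸_; _≤_; _<_; z≤n; s≤s)
open import Data.Nat.Properties
  using (≤-trans; ≤-<-trans; n<1+n; m≤m+n; +-comm; +-assoc; +-identityʳ; m+[n∸m]≡n; +-monoʳ-≤; +-monoʳ-<; +-monoˡ-<;
         +-mono-≤-<; *-monoˡ-≤; *-monoʳ-≤; pred[m∸n]≡m∸[1+n]; suc[m]≤n⇒m≤pred[n]; module ≤-Reasoning)
open import Data.Nat.Induction using (<-wellFounded)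
open import Induction.WellFounded using (Acc; acc)
open import Data.Fin using (Fin; zero; suc; _≟_; join; splitAt)
open import Data.Fin.Properties using (suc-injective; 0≢1+n; splitAt-join; any?; all?)
open import Data.Fin.Subset using (Subset; _∈_; _∉_; _⊂_; _-_; ⊤; inside; outside; ∁; ∣_∣)
open import Data.Fin.Subset.Properties
  using (x∈p⇒∣p-x∣<∣p∣; x∈p∧x≢y⇒x∈p-y; p⊂q⇒∣p∣<∣q∣; ∈⊤; ∣⊤∣≡n; ∣∁p∣≡n∸∣p∣; ∣p∣≤n; x∉p⇒x∈∁p; _∈?_)
open import Data.Vec using ([]; _∷_; _++_; tabulate; here; there)
open import Data.Vec.Properties using (lookup∘tabulate; []=⇒lookup; lookup⇒[]=)
open import Data.Bool using (true)
import Data.Bool.Properties as Bool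
open import Data.Product using (∃; _×_; _,_; proj₂)
open import Data.Sum using (_⊎_; inj₁; inj₂)
open import Data.Sum.Properties using (inj₁-injective; inj₂-injective)
open import Relation.Binary.PropositionalEquality
  using (_≡_; _≢_; refl; trans; cong; subst) renaming (sym to ≡-sym)
open import Relation.Nullary using (¬_; Dec; yes; no; does; contradiction)
open import Relation.Nullary.Decidable using (_×-dec_; _⊎-dec_; _→-dec_; ¬?; decidable-stable; dec-true)
open import Relation.Unary using (Pred; Decidable)
open import Function using (_∘_)
open import Level using (0ℓ)

card-≤ : ∀ {k m} (P : Subset k) (R : Subset m) (f : Fin k → Fin m)
  → (∀ {x} → x ∈ P → f x ∈ R)
  → (∀ {x y} → x ∈ P → y ∈ P → f x ≡ f y → x ≡ y)
  → ∣ P ∣ ≤ ∣ R ∣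
card-≤ [] R f _ _ = z≤n
card-≤ (outside ∷ P) R f into inj =
  card-≤ P R (f ∘ suc) (into ∘ there) (λ x∈P y∈P → suc-injective ∘ inj (there x∈P) (there y∈P))
card-≤ (inside ∷ P) R f into inj =
  ≤-trans (s≤s (card-≤ P (R - f zero) (f ∘ suc) into′
                       (λ x∈P y∈P → suc-injective ∘ inj (there x∈P) (there y∈P))))
          (x∈p⇒∣p-x∣<∣p∣ (into here))
  where
  -- the image of zero is used up, so the rest of P lands in R minus it
  into′ : ∀ {x} → x ∈ P → f (suc x) ∈ R - f zero
  into′ x∈P = x∈p∧x≢y⇒x∈p-y (into (there x∈P)) (0≢1+n ∘ inj here (there x∈P) ∘ ≡-sym)

∣++∣ : ∀ {n m} (Q : Subset n) (R : Subset m) → ∣ Q ++ R ∣ ≡ ∣ Q ∣ + ∣ R ∣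
∣++∣ [] R = refl
∣++∣ (outside ∷ Q) R = ∣++∣ Q R
∣++∣ (inside ∷ Q) R = cong suc (∣++∣ Q R)

InSum : ∀ {n m} → Subset n → Subset m → Fin n ⊎ Fin m → Set
InSum Q R (inj₁ x) = x ∈ Q
InSum Q R (inj₂ y) = y ∈ R

∈-++ : ∀ {n m} (Q : Subset n) (R : Subset m) (z : Fin n ⊎ Fin m) → InSum Q R z → join n m z ∈ Q ++ R
∈-++ (_ ∷ Q) R (inj₁ zero) here = here
∈-++ (_ ∷ Q) R (inj₁ (suc x)) (there x∈Q) = there (∈-++ Q R (inj₁ x) x∈Q)
∈-++ [] R (inj₂ y) y∈R = y∈R
∈-++ (_ ∷ Q) R (inj₂ y) y∈R = there (∈-++ Q R (inj₂ y) y∈R)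

card-⊎ : ∀ {k n m} (P : Subset k) (Q : Subset n) (R : Subset m) (f : Fin k → Fin n ⊎ Fin m)
  → (∀ {x} → x ∈ P → InSum Q R (f x))
  → (∀ {x y} → x ∈ P → y ∈ P → f x ≡ f y → x ≡ y)
  → ∣ P ∣ ≤ ∣ Q ∣ + ∣ R ∣
card-⊎ {n = n} {m} P Q R f into inj =
  subst (∣ P ∣ ≤_) (∣++∣ Q R)
    (card-≤ P (Q ++ R) (join n m ∘ f) (λ {x} x∈P → ∈-++ Q R (f x) (into x∈P))
            (λ x∈P y∈P → inj x∈P y∈P ∘ join-injective))
  where
  -- join is a bijection Fin n ⊎ Fin m ≅ Fin (n + m) with inverse splitAt
  join-injective : ∀ {z z′} → join n m z ≡ join n m z′ → z ≡ z′
  join-injective {z} {z′} e = trans (≡-sym (splitAt-join n m z)) (trans (cong (splitAt n) e) (splitAt-join n m z′))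

⟦_⟧ : ∀ {n} {P : Pred (Fin n) 0ℓ} → Decidable P → Subset n
⟦ P? ⟧ = tabulate (λ x → does (P? x))

∈⟦⟧⁺ : ∀ {n} {P : Pred (Fin n) 0ℓ} (P? : Decidable P) {x} → P x → x ∈ ⟦ P? ⟧
∈⟦⟧⁺ P? {x} px = lookup⇒[]= x _ (trans (lookup∘tabulate _ x) (dec-true (P? x) px))

∈⟦⟧⁻ : ∀ {n} {P : Pred (Fin n) 0ℓ} (P? : Decidable P) {x} → x ∈ ⟦ P? ⟧ → P x
∈⟦⟧⁻ P? {x} x∈ with P? x | trans (≡-sym (lookup∘tabulate (λ y → does (P? y)) x)) ([]=⇒lookup x∈)
... | yes px | _ = px
... | no _ | ()

-- The counting gives the strict bound 2∣S∣ < n + c; this turns it into the stated form.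
<⇒≤∸1 : ∀ {a m} → a < m → a ≤ m ∸ 1
<⇒≤∸1 {a} {m} a<m = subst (a ≤_) (pred[m∸n]≡m∸[1+n] m 0) (suc[m]≤n⇒m≤pred[n] a<m)

weighted-< : ∀ {n a b i j} → a < b → i ≤ n → a * suc n + i < b * suc n + j
weighted-< {n} {a} {b} {i} {j} a<b i≤n = begin-strict
  a * suc n + i     ≤⟨ +-monoʳ-≤ (a * suc n) i≤n ⟩
  a * suc n + n     <⟨ +-monoʳ-< (a * suc n) (n<1+n n) ⟩
  a * suc n + suc n ≡⟨ +-comm (a * suc n) (suc n) ⟩
  suc a * suc n     ≤⟨ *-monoˡ-≤ (suc n) a<b ⟩
  b * suc n         ≤⟨ m≤m+n (b * suc n) j ⟩
  b * suc n + j     ∎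
  where open ≤-Reasoning

double-≤-colours : ∀ {n c s} → s ≤ c → c < n → 2 * s ≤ n + c ∸ 1
double-≤-colours {n} {c} {s} s≤c c<n = <⇒≤∸1 (begin-strict
  2 * s ≤⟨ *-monoʳ-≤ 2 s≤c ⟩
  c + (c + 0) ≡⟨ cong (c +_) (+-identityʳ c) ⟩
  c + c <⟨ +-monoˡ-< c c<n ⟩
  n + c ∎)
  where open ≤-Reasoning

double-≤-outside : ∀ {n c s t} → s ≤ n → s ≤ (n ∸ s) + t → t < c → 2 * s ≤ n + c ∸ 1
double-≤-outside {n} {c} {s} {t} s≤n s≤rest t<c = <⇒≤∸1 (begin-strict
  s + (s + 0)       ≡⟨ cong (s +_) (+-identityʳ s) ⟩
  s + s             ≤⟨ +-monoʳ-≤ s s≤rest ⟩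
  s + ((n ∸ s) + t) ≡⟨ ≡-sym (+-assoc s (n ∸ s) t) ⟩
  s + (n ∸ s) + t   ≡⟨ cong (_+ t) (m+[n∸m]≡n s≤n) ⟩
  n + t             <⟨ +-monoʳ-< n t<c ⟩
  n + c             ∎)
  where open ≤-Reasoning

descend : ∀ {A : Set} (μ : A → ℕ) (Inv Final : A → Set)
  → (∀ a → Inv a → Final a ⊎ ∃ λ b → Inv b × μ b < μ a)
  → ∀ a → Inv a → ∃ λ b → Inv b × Final b
descend μ Inv Final improve a inv = go a inv (<-wellFounded (μ a))
  where
  go : ∀ a → Inv a → Acc _<_ (μ a) → ∃ λ b → Inv b × Final b
  go a inv (acc smaller) with improve a inv
  ... | inj₁ final = a , inv , final
  ... | inj₂ (b , inv′ , μb<μa) = go b inv′ (smaller μb<μa)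

adj? : ∀ {n} (G : Graph n) u v → Dec (Adj G u v)
adj? G u v = adj G u v Bool.≟ true

adj-sym : ∀ {n} (G : Graph n) {u v} → Adj G u v → Adj G v u
adj-sym G {u} {v} a = trans (Graph.sym G v u) a

adj⇒≢ : ∀ {n} (G : Graph n) {u v} → Adj G u v → u ≢ v
adj⇒≢ G {u} a refl = contradiction (trans (≡-sym a) (irrefl G u)) λ ()

has-neighbour : ∀ {n} (G : Graph n) → Connected G → 1 < n → ∀ v → ∃ (Adj G v)
has-neighbour G conn (s≤s (s≤s _)) v = first-step (other v) (other≢ v) (conn v (other v))
  where
  other : ∀ {k} → Fin (suc (suc k)) → Fin (suc (suc k))
  other zero = suc zero
  other (suc _) = zero
  other≢ : ∀ {k} (x : Fin (suc (suc k))) → other x ≢ x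
  other≢ zero ()
  other≢ (suc _) ()
  first-step : ∀ u → u ≢ v → Walk G v u → ∃ (Adj G v)
  first-step u u≢v here = contradiction refl u≢v
  first-step u _ (step a _) = _ , a

module Tropical {n c : ℕ} (G : Graph n) (κ : Colouring {n} c) where

  TD : Subset n → Set
  TD = TropicalDominating G κ

  PrivateNeighbour : Subset n → Fin n → Fin n → Set
  PrivateNeighbour S v w = w ∉ S × Adj G v w × (∀ u → u ∈ S → Adj G u w → u ≡ v)

  HasPrivate : Subset n → Fin n → Set
  HasPrivate S v = ∃ (PrivateNeighbour S v)

  Twin : Subset n → Fin n → Set
  Twin S v = ∃ λ u → u ∈ S × col κ u ≡ col κ v × u ≢ v

  NeighbourIn : Subset n → Fin n → Set
  NeighbourIn S v = ∃ λ u → u ∈ S × Adj G v u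

  Stable : Subset n → Set
  Stable S = ∀ v → v ∈ S → HasPrivate S v ⊎ ¬ Twin S v

  hasPrivate? : ∀ S v → Dec (HasPrivate S v)
  hasPrivate? S v = any? λ w → ¬? (w ∈? S) ×-dec adj? G v w ×-dec
                               all? (λ u → u ∈? S →-dec adj? G u w →-dec u ≟ v)

  twin? : ∀ S v → Dec (Twin S v)
  twin? S v = any? λ u → u ∈? S ×-dec col κ u ≟ col κ v ×-dec ¬? (u ≟ v)

  neighbourIn? : ∀ S v → Dec (NeighbourIn S v)
  neighbourIn? S v = any? λ u → u ∈? S ×-dec adj? G v u

  isolated? : ∀ S → Decidable (λ x → x ∈ S × ¬ NeighbourIn S x)
  isolated? S x = x ∈? S ×-dec ¬? (neighbourIn? S x)

  isolatedIn : Subset n → Subset n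
  isolatedIn S = ⟦ isolated? S ⟧

  -- deleting vertices matters more than reducing the isolated ones
  measure : Subset n → ℕ
  measure S = ∣ S ∣ * suc n + ∣ isolatedIn S ∣

  other-dominator : ∀ {S v x} → TD S → ¬ HasPrivate S v → x ∉ S → ∃ λ y → y ∈ S × Adj G y x × y ≢ v
  other-dominator {S} {v} {x} (dom , _) noPrivate x∉S with dom x
  ... | inj₁ x∈S = contradiction x∈S x∉S
  ... | inj₂ (y , y∈S , yx) with y ≟ v
  ...   | no y≢v = y , y∈S , yx , y≢v
  ...   | yes refl with any? (λ u → u ∈? S ×-dec adj? G u x ×-dec ¬? (u ≟ v))
  ...     | yes other = other
  ...     | no none = contradiction (x , x∉S , yx , only-v) noPrivate
    where
    only-v : ∀ u → u ∈ S → Adj G u x → u ≡ v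
    only-v u u∈S ux = decidable-stable (u ≟ v) (λ u≢v → none (u , u∈S , ux , u≢v))

  exchange : ∀ {S S′ v} → TD S → ¬ HasPrivate S v → Twin S v →
             (∀ x → x ∈ S → x ≢ v → x ∈ S′) → NeighbourIn S′ v → TD S′
  exchange {S} {S′} {v} td@(_ , colours) noPrivate (t , t∈S , same , t≢v) keep (d , d∈S′ , vd) =
    dominating , colours′
    where
    dominating : Dominating G S′
    dominating x with x ≟ v | x ∈? S
    ... | yes refl | _ = inj₂ (d , d∈S′ , adj-sym G vd)
    ... | no x≢v | yes x∈S = inj₁ (keep x x∈S x≢v)
    ... | no _ | no x∉S with other-dominator td noPrivate x∉S
    ...   | y , y∈S , yx , y≢v = inj₂ (y , keep y y∈S y≢v , yx)
    colours′ : ∀ i → ∃ λ z → z ∈ S′ × col κ z ≡ i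
    colours′ i with colours i
    ... | y , y∈S , cy with y ≟ v
    ...   | no y≢v = y , keep y y∈S y≢v , cy
    ...   | yes refl = t , keep t t∈S t≢v , trans same cy

  delete-step : ∀ {S v} → TD S → v ∈ S → ¬ HasPrivate S v → Twin S v → NeighbourIn S v →
                TD (S - v) × measure (S - v) < measure S
  delete-step {S} {v} td v∈S noPrivate twin (u , u∈S , vu) =
    exchange td noPrivate twin (λ _ x∈S x≢v → x∈p∧x≢y⇒x∈p-y x∈S x≢v)
             (u , x∈p∧x≢y⇒x∈p-y u∈S (adj⇒≢ G (adj-sym G vu)) , vu)
    , weighted-< (x∈p⇒∣p-x∣<∣p∣ v∈S) (∣p∣≤n (isolatedIn (S - v)))

  module Swap {S v w} (td : TD S) (v∈S : v ∈ S) (noPrivate : ¬ HasPrivate S v) (twin : Twin S v)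
              (isolated : ¬ NeighbourIn S v) (vw : Adj G v w) where

    S′? : Decidable (λ x → x ≡ w ⊎ (x ∈ S × x ≢ v))
    S′? x = x ≟ w ⊎-dec (x ∈? S ×-dec ¬? (x ≟ v))

    S′ : Subset n
    S′ = ⟦ S′? ⟧

    keep : ∀ x → x ∈ S → x ≢ v → x ∈ S′
    keep x x∈S x≢v = ∈⟦⟧⁺ S′? (inj₂ (x∈S , x≢v))

    w∉S : w ∉ S
    w∉S w∈S = isolated (w , w∈S , vw)

    v∉S′ : v ∉ S′
    v∉S′ v∈S′ with ∈⟦⟧⁻ S′? v∈S′
    ... | inj₁ v≡w = adj⇒≢ G vw v≡w
    ... | inj₂ (_ , v≢v) = v≢v refl

    tropical : TD S′
    tropical = exchange td noPrivate twin keep (w , ∈⟦⟧⁺ S′? (inj₁ refl) , vw)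

    back : Fin n → Fin n
    back x with x ≟ w
    ... | yes _ = v
    ... | no _ = x

    back-into : ∀ {x} → x ∈ S′ → back x ∈ S
    back-into {x} x∈S′ with x ≟ w | ∈⟦⟧⁻ S′? x∈S′
    ... | yes _ | _ = v∈S
    ... | no x≢w | inj₁ x≡w = contradiction x≡w x≢w
    ... | no _ | inj₂ (x∈S , _) = x∈S

    back-injective : ∀ {x y} → x ∈ S′ → y ∈ S′ → back x ≡ back y → x ≡ y
    back-injective {x} {y} x∈S′ y∈S′ e with x ≟ w | y ≟ w
    ... | yes x≡w | yes y≡w = trans x≡w (≡-sym y≡w)
    ... | yes _ | no _ = contradiction (subst (_∈ S′) (≡-sym e) y∈S′) v∉S′
    ... | no _ | yes _ = contradiction (subst (_∈ S′) e x∈S′) v∉S′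
    ... | no _ | no _ = e

    -- w has a neighbour in S other than v, so the swap leaves no new isolated vertex,
    -- while v itself stops being isolated in S
    fewer-isolated : isolatedIn S′ ⊂ isolatedIn S
    fewer-isolated = shrink , v , ∈⟦⟧⁺ (isolated? S) (v∈S , isolated) , v∉S′ ∘ proj-member
      where
      proj-member : ∀ {x} → x ∈ isolatedIn S′ → x ∈ S′
      proj-member x∈ with ∈⟦⟧⁻ (isolated? S′) x∈
      ... | x∈S′ , _ = x∈S′
      shrink : ∀ {x} → x ∈ isolatedIn S′ → x ∈ isolatedIn S
      shrink {x} x∈ with ∈⟦⟧⁻ (isolated? S′) x∈
      ... | x∈S′ , alone with ∈⟦⟧⁻ S′? x∈S′
      ...   | inj₁ refl with other-dominator td noPrivate w∉S
      ...     | y , y∈S , yw , y≢v = contradiction (y , keep y y∈S y≢v , adj-sym G yw) alone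
      shrink {x} x∈ | x∈S′ , alone | inj₂ (x∈S , x≢v) = ∈⟦⟧⁺ (isolated? S) (x∈S , alone-in-S)
        where
        alone-in-S : ¬ NeighbourIn S x
        alone-in-S (u , u∈S , xu) with u ≟ v
        ... | yes refl = isolated (x , x∈S , adj-sym G xu)
        ... | no u≢v = alone (u , keep u u∈S u≢v , xu)

    smaller : measure S′ < measure S
    smaller = +-mono-≤-< (*-monoˡ-≤ (suc n) (card-≤ S′ S back back-into back-injective))
                         (p⊂q⇒∣p∣<∣q∣ fewer-isolated)

  improve : (∀ v → ∃ (Adj G v)) → ∀ S → TD S → Stable S ⊎ ∃ λ S′ → TD S′ × measure S′ < measure S
  improve neighbour S td with any? (λ v → v ∈? S ×-dec ¬? (hasPrivate? S v) ×-dec twin? S v)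
  ... | no none = inj₁ stable
    where
    stable : Stable S
    stable v v∈S with hasPrivate? S v
    ... | yes p = inj₁ p
    ... | no noPrivate = inj₂ (λ twin → none (v , v∈S , noPrivate , twin))
  ... | yes (v , v∈S , noPrivate , twin) with neighbourIn? S v
  ...   | yes inS = inj₂ (S - v , delete-step td v∈S noPrivate twin inS)
  ...   | no isolated =
    let open Swap td v∈S noPrivate twin isolated (proj₂ (neighbour v)) in inj₂ (S′ , tropical , smaller)

  module _ {S : Subset n} (stable : Stable S) where

    colour-unique : ∀ {x y} → x ∈ S → y ∈ S → ¬ HasPrivate S y → col κ x ≡ col κ y → x ≡ y
    colour-unique {x} {y} x∈S y∈S noPrivate same with stable y y∈S
    ... | inj₁ p = contradiction p noPrivate
    ... | inj₂ noTwin = decidable-stable (x ≟ y) (λ x≢y → noTwin (x , x∈S , same , x≢y))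

    bound-by-colours : (¬ ∃ λ v → v ∈ S × HasPrivate S v) → ∣ S ∣ ≤ c
    bound-by-colours none = subst (∣ S ∣ ≤_) (∣⊤∣≡n c)
      (card-≤ S ⊤ (col κ) (λ _ → ∈⊤)
              (λ x∈S y∈S → colour-unique x∈S y∈S (λ p → none (_ , y∈S , p))))

    module Labels {v₀} (v₀∈S : v₀ ∈ S) (p₀ : HasPrivate S v₀) where

      label : Fin n → Fin n ⊎ Fin c
      label x with hasPrivate? S x
      ... | yes (w , _) = inj₁ w
      ... | no _ = inj₂ (col κ x)

      label-into : ∀ {x} → x ∈ S → InSum (∁ S) (⊤ - col κ v₀) (label x)
      label-into {x} x∈S with hasPrivate? S x
      ... | yes (w , w∉S , _) = x∉p⇒x∈∁p w∉S
      ... | no noPrivate = x∈p∧x≢y⇒x∈p-y ∈⊤ (λ same → noPrivate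
                             (subst (HasPrivate S) (colour-unique v₀∈S x∈S noPrivate (≡-sym same)) p₀))

      label-injective : ∀ {x y} → x ∈ S → y ∈ S → label x ≡ label y → x ≡ y
      label-injective {x} {y} x∈S y∈S e with hasPrivate? S x | hasPrivate? S y
      label-injective x∈S y∈S e | yes (_ , _ , _ , only-x) | yes (_ , _ , yw , _) =
        ≡-sym (only-x _ y∈S (subst (Adj G _) (≡-sym (inj₁-injective e)) yw))
      label-injective x∈S y∈S () | yes _ | no _
      label-injective x∈S y∈S () | no _ | yes _
      label-injective x∈S y∈S e | no _ | no noPrivate = colour-unique x∈S y∈S noPrivate (inj₂-injective e)

      bound-by-labels : ∣ S ∣ ≤ (n ∸ ∣ S ∣) + ∣ ⊤ - col κ v₀ ∣
      bound-by-labels = subst (λ k → ∣ S ∣ ≤ k + ∣ ⊤ - col κ v₀ ∣) (∣∁p∣≡n∸∣p∣ S)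
        (card-⊎ S (∁ S) (⊤ - col κ v₀) label label-into label-injective)

    stable-bound : c < n → 2 * ∣ S ∣ ≤ n + c ∸ 1
    stable-bound c<n with any? (λ v → v ∈? S ×-dec hasPrivate? S v)
    ... | no none = double-≤-colours (bound-by-colours none) c<n
    ... | yes (v₀ , v₀∈S , p₀) =
      double-≤-outside (∣p∣≤n S) (Labels.bound-by-labels v₀∈S p₀)
        (subst (∣ ⊤ - col κ v₀ ∣ <_) (∣⊤∣≡n c) (x∈p⇒∣p-x∣<∣p∣ (∈⊤ {x = col κ v₀})))

mainTheorem5 : (n c : ℕ) → 1 ≤ c → c < n →
    (G : Graph n) → (κ : Colouring {n} c) → Connected G →
    ∃ λ S → TropicalDominating G κ S × 2 * ∣ S ∣ ≤ n + c ∸ 1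
mainTheorem5 n c 1≤c c<n G κ conn =
  let (S , td , stable) = descend measure TD Stable (improve neighbour) ⊤ everything
  in S , td , stable-bound stable c<n
  where
  open Tropical G κ
  neighbour : ∀ v → ∃ (Adj G v)
  neighbour = has-neighbour G conn (≤-<-trans 1≤c c<n)
  -- the whole vertex set is tropical dominating since every colour is used
  everything : TD ⊤
  everything = (λ _ → inj₁ ∈⊤) , λ i → let (v , cv) = onto κ i in v , ∈⊤ , cv
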